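{- Let $n\ge 6$ be an integer and $N=T_n=n(n+1)/2$. If $\lambda=(\lambda_1,\dots,\lambda_t)$ is a maximal unrefinable partition of $N$, then $\lambda_i\neq n-2$ for every $1\le i\le t$.
   Context: A partition of $N$ into distinct parts is a sequence of positive integers $\lambda_1<\dots<\lambda_t$ with $t\ge2$ summing to $N$. Missing parts are the elements of $\{1,\dots,\lambda_t\}\setminus\{\lambda_1,\dots,\lambda_t\}$. The partition is refinable if some part equals the sum of two distinct missing parts, and unrefinable otherwise. An unrefinable partition of $N$ is maximal if its largest part is the largest possible largest part among all unrefinable partitions of $N$. -}

module Defs where

open import Data.Nat using (ℕ; zero; suc; _+_; _*_; _≤_; _<_; _⊔_)
open import Data.List using (List; []; _∷_; length; foldr)
open import Data.Nat.ListAction using (sum)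
open import Data.List.Relation.Unary.All using (All)
open import Data.List.Relation.Unary.Linked using (Linked)
open import Data.List.Membership.Propositional using (_∈_; _∉_)
open import Data.Product using (_×_; ∃; ∃-syntax)
open import Relation.Binary.PropositionalEquality using (_≡_; _≢_)
open import Relation.Nullary using (¬_)

T : ℕ → ℕ
T zero = zero
T (suc n) = T n + suc n

-- Largest part of a list of naturals (0 for the empty list).
-- For a strictly increasing list this is the last element λ_t.
largest : List ℕ → ℕ
largest = foldr _⊔_ 0

record DistinctPartition (N : ℕ) (ps : List ℕ) : Set where
  field
    increasing : Linked _<_ ps
    positive   : All (1 ≤_) ps
    atLeastTwo : 2 ≤ length ps
    sums       : sum ps ≡ N

Missing : List ℕ → ℕ → Set
Missing ps m = (1 ≤ m) × (m ≤ largest ps) × (m ∉ ps)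

Refinable : List ℕ → Set
Refinable ps =
  ∃[ p ] ∃[ a ] ∃[ b ] (p ∈ ps × Missing ps a × Missing ps b × a ≢ b × a + b ≡ p)

Unrefinable : List ℕ → Set
Unrefinable ps = ¬ Refinable ps

UnrefinablePartition : ℕ → List ℕ → Set
UnrefinablePartition N ps = DistinctPartition N ps × Unrefinable ps

MaximalUnrefinable : ℕ → List ℕ → Set
MaximalUnrefinable N ps =
  UnrefinablePartition N ps ×
  (∀ qs → UnrefinablePartition N qs → largest qs ≤ largest ps)

{-# OPTIONS --safe #-}
module Submission where

-- Write k = n − 2 and L for the largest part.  The partition {1, …, k − 1, k + 3, 2k} of
-- T (k + 2) is unrefinable, because its missing parts are ≥ k and two distinct ones add up to
-- more than 2k; hence a maximal partition has L ≥ 2k.  Unrefinability forces a or L − a to be a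
-- part whenever 2a < L, so the pair {a, L − a} contributes a, L − a or L to the sum of the
-- parts, i.e. a plus an excess.  Summing over the pairs gives T (k + 2) ≥ T j + L for 2j < L,
-- whence L ≤ 2k + 2, and the exact balance of excesses rules out the remaining values:
--  * L = 2k + 2: the pairs a ≤ k have total excess 0 or ≥ 2, the middle k + 1 contributes 0 or
--    k + 1, but the balance requires 1;
--  * L = 2k + 1, k a part: the pairs a < k have total excess 0 or ≥ 3 and the pair {k, k + 1}
--    contributes k or L, but their sum must be k + 2;
--  * L = 2k, k a part: every pair a < k has even excess or excess > k, but the total excess
--    must be 3.

open import Defs
open import Data.Nat using (ℕ; zero; suc; _+_; _*_; _∸_; _≤_; _<_; _≟_; z≤n; s≤s; s≤s⁻¹)
open import Data.Nat.Properties
open import Data.Nat.Divisibility using (_∣_; divides; _∣0; ∣m∣n⇒∣m+n)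
open import Data.Nat.ListAction using (sum)
open import Data.Nat.ListAction.Properties using (sum-++)
open import Data.Nat.Tactic.RingSolver using (solve-∀)
open import Data.List using (List; []; _∷_; _++_; _∷ʳ_; length; applyUpTo)
open import Data.List.Properties using (length-++; applyUpTo-∷ʳ)
open import Data.List.Membership.Propositional using (_∈_; _∉_)
open import Data.List.Membership.Propositional.Properties
  using (∈-++⁺ˡ; ∈-++⁺ʳ; ∈-applyUpTo⁺; ∈-applyUpTo⁻)
open import Data.List.Membership.DecPropositional _≟_ using (_∈?_)
open import Data.List.Relation.Unary.All as All using (All; []; _∷_)
open import Data.List.Relation.Unary.All.Properties using (All¬⇒¬Any)
import Data.List.Relation.Unary.All.Properties as Allₚ
open import Data.List.Relation.Unary.AllPairs as AllPairs using ([]; _∷_)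
import Data.List.Relation.Unary.AllPairs.Properties as AllPairsₚ
open import Data.List.Relation.Unary.Any using (here; there)
open import Data.List.Relation.Unary.Linked.Properties
  using (Linked⇒AllPairs; AllPairs⇒Linked; applyUpTo⁺₂)
open import Data.List.Relation.Unary.Unique.Propositional using (Unique)
open import Data.Product using (∃-syntax; _×_; _,_; proj₁; proj₂)
open import Data.Sum using (_⊎_; inj₁; inj₂; [_,_]′)
open import Data.Empty using (⊥; ⊥-elim)
open import Function using (_∘_)
open import Relation.Nullary using (¬_; yes; no)
open import Relation.Binary.PropositionalEquality
open import Algebra.Properties.CommutativeSemigroup +-commutativeSemigroup using (interchange)

m+n≤o⇒n≤o∸m : ∀ m {n o} → m + n ≤ o → n ≤ o ∸ m
m+n≤o⇒n≤o∸m m {n} {o} m+n≤o = m+n≤o⇒m≤o∸n n (subst (_≤ o) (+-comm m n) m+n≤o)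

+-cancelˡʳ-≡ : ∀ a {x y} c → a + x + c ≡ a + y + c → x ≡ y
+-cancelˡʳ-≡ a {x} {y} c eq = +-cancelˡ-≡ a x y (+-cancelʳ-≡ c (a + x) (a + y) eq)

sumFrom : (ℕ → ℕ) → ℕ → ℕ → ℕ
sumFrom f lo zero      = 0
sumFrom f lo (suc len) = f lo + sumFrom f (suc lo) len

sumFrom-snoc : ∀ f lo len → sumFrom f lo (suc len) ≡ sumFrom f lo len + f (lo + len)
sumFrom-snoc f lo zero      = trans (+-identityʳ (f lo)) (cong f (sym (+-identityʳ lo)))
sumFrom-snoc f lo (suc len) rewrite sumFrom-snoc f (suc lo) len | +-suc lo len =
  sym (+-assoc (f lo) _ _)

sumFrom-+ : ∀ f g lo len →
            sumFrom (λ x → f x + g x) lo len ≡ sumFrom f lo len + sumFrom g lo len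
sumFrom-+ f g lo zero      = refl
sumFrom-+ f g lo (suc len) rewrite sumFrom-+ f g (suc lo) len =
  interchange (f lo) (g lo) (sumFrom f (suc lo) len) (sumFrom g (suc lo) len)

sumFrom-zero : ∀ lo len → sumFrom (λ _ → 0) lo len ≡ 0
sumFrom-zero lo zero      = refl
sumFrom-zero lo (suc len) = sumFrom-zero (suc lo) len

sumFrom-pairs : ∀ (f : ℕ → ℕ) {L} j len → suc (j + j + len) ≡ L →
                sumFrom f 1 (j + j + len) ≡
                sumFrom (λ a → f a + f (L ∸ a)) 1 j + sumFrom f (suc j) len
sumFrom-pairs f     zero    len _  = refl
sumFrom-pairs f {L} (suc j) len eq = begin
  sumFrom f 1 (suc j + suc j + len)
    ≡⟨ cong (sumFrom f 1) (shift j len) ⟩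
  sumFrom f 1 (j + j + suc (suc len))
    ≡⟨ sumFrom-pairs f j (suc (suc len)) (trans (cong suc (sym (shift j len))) eq) ⟩
  P + (f (suc j) + sumFrom f (2 + j) (suc len))
    ≡⟨ cong (λ s → P + (f (suc j) + s)) (sumFrom-snoc f (2 + j) len) ⟩
  P + (f (suc j) + (M + f (2 + j + len)))
    ≡⟨ cong (λ x → P + (f (suc j) + (M + f x))) mirror ⟩
  P + (f (suc j) + (M + f (L ∸ suc j)))
    ≡⟨ regroup P (f (suc j)) M (f (L ∸ suc j)) ⟩
  P + (f (suc j) + f (L ∸ suc j)) + M
    ≡⟨ cong (_+ M) (sumFrom-snoc g 1 j) ⟨
  sumFrom g 1 (suc j) + M ∎
  where
    open ≡-Reasoning
    g = λ a → f a + f (L ∸ a)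
    P = sumFrom g 1 j
    M = sumFrom f (2 + j) len
    shift : ∀ j len → suc j + suc j + len ≡ j + j + suc (suc len)
    shift = solve-∀
    regroup : ∀ p a m b → p + (a + (m + b)) ≡ p + (a + b) + m
    regroup = solve-∀
    unfold : ∀ j len → 2 + j + len + suc j ≡ suc (suc j + suc j + len)
    unfold = solve-∀
    mirror : 2 + j + len ≡ L ∸ suc j
    mirror = begin
      2 + j + len                  ≡⟨ m+n∸n≡m (2 + j + len) (suc j) ⟨
      2 + j + len + suc j ∸ suc j  ≡⟨ cong (_∸ suc j) (trans (unfold j len) eq) ⟩
      L ∸ suc j                    ∎

δ : ℕ → ℕ → ℕ
δ p x with x ≟ p
... | yes _ = p
... | no  _ = 0

δ-diag : ∀ p → δ p p ≡ p
δ-diag p with p ≟ p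
... | yes _   = refl
... | no  p≢p = ⊥-elim (p≢p refl)

δ-≢ : ∀ {p x} → x ≢ p → δ p x ≡ 0
δ-≢ {p} {x} x≢p with x ≟ p
... | yes x≡p = ⊥-elim (x≢p x≡p)
... | no  _   = refl

sumFrom-δ-below : ∀ {p lo} len → p < lo → sumFrom (δ p) lo len ≡ 0
sumFrom-δ-below zero      _    = refl
sumFrom-δ-below (suc len) p<lo =
  cong₂ _+_ (δ-≢ (≢-sym (<⇒≢ p<lo))) (sumFrom-δ-below len (m<n⇒m<1+n p<lo))

sumFrom-δ-inside : ∀ {p lo} len → lo ≤ p → p < lo + len → sumFrom (δ p) lo len ≡ p
sumFrom-δ-inside {p} {lo} zero lo≤p p<lo+0 =
  ⊥-elim (<⇒≱ p<lo+0 (subst (_≤ p) (sym (+-identityʳ lo)) lo≤p))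
sumFrom-δ-inside {p} {lo} (suc len) lo≤p p<lo+len with m≤n⇒m<n∨m≡n lo≤p
... | inj₂ refl = trans (cong₂ _+_ (δ-diag p) (sumFrom-δ-below len ≤-refl)) (+-identityʳ p)
... | inj₁ lo<p = trans (cong (_+ sumFrom (δ p) (suc lo) len) (δ-≢ (<⇒≢ lo<p)))
                        (sumFrom-δ-inside len lo<p (subst (p <_) (+-suc lo len) p<lo+len))

weight : List ℕ → ℕ → ℕ
weight []       x = 0
weight (p ∷ ps) x = δ p x + weight ps x

sum≡sumFrom-weight : ∀ {L} ps → All (_≤ L) ps → sum ps ≡ sumFrom (weight ps) 0 (suc L)
sum≡sumFrom-weight {L} []       _            = sym (sumFrom-zero 0 (suc L))
sum≡sumFrom-weight {L} (p ∷ ps) (p≤L ∷ ps≤L) = begin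
  p + sum ps
    ≡⟨ cong₂ _+_ (sym (sumFrom-δ-inside (suc L) z≤n (s≤s p≤L))) (sum≡sumFrom-weight ps ps≤L) ⟩
  sumFrom (δ p) 0 (suc L) + sumFrom (weight ps) 0 (suc L)
    ≡⟨ sumFrom-+ (δ p) (weight ps) 0 (suc L) ⟨
  sumFrom (weight (p ∷ ps)) 0 (suc L) ∎
  where open ≡-Reasoning

weight-∉ : ∀ {x} ps → x ∉ ps → weight ps x ≡ 0
weight-∉ []       _   = refl
weight-∉ (p ∷ ps) x∉ = cong₂ _+_ (δ-≢ (x∉ ∘ here)) (weight-∉ ps (x∉ ∘ there))

weight-∈ : ∀ {x ps} → Unique ps → x ∈ ps → weight ps x ≡ x
weight-∈ {x} {p ∷ ps} (p≢ps ∷ _) (here refl) =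
  trans (cong₂ _+_ (δ-diag x) (weight-∉ ps (All¬⇒¬Any p≢ps))) (+-identityʳ x)
weight-∈ {x} {p ∷ ps} (p≢ps ∷ unique) (there x∈ps) =
  trans (cong (_+ weight ps x) (δ-≢ (≢-sym (All.lookup p≢ps x∈ps)))) (weight-∈ unique x∈ps)

weight-cases : ∀ {ps} → Unique ps → ∀ x → weight ps x ≡ 0 ⊎ weight ps x ≡ x
weight-cases {ps} unique x with x ∈? ps
... | yes x∈ps = inj₂ (weight-∈ unique x∈ps)
... | no  x∉ps = inj₁ (weight-∉ ps x∉ps)

∈⇒≤largest : ∀ {x} xs → x ∈ xs → x ≤ largest xs
∈⇒≤largest (y ∷ ys) (here refl)  = m≤m⊔n y (largest ys)
∈⇒≤largest (y ∷ ys) (there x∈ys) = ≤-trans (∈⇒≤largest ys x∈ys) (m≤n⊔m y (largest ys))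

largest∈ : ∀ xs → 1 ≤ length xs → largest xs ∈ xs
largest∈ (x ∷ [])     _ = here (⊔-identityʳ x)
largest∈ (x ∷ y ∷ ys) _ =
  [ here , (λ x⊔l≡l → subst (_∈ x ∷ y ∷ ys) (sym x⊔l≡l) (there (largest∈ (y ∷ ys) (s≤s z≤n)))) ]′
  (⊔-sel x (largest (y ∷ ys)))

unrefinable⇒complement : ∀ {ps p a} → Unrefinable ps → p ∈ ps → 1 ≤ a → a + a < p →
                         a ∈ ps ⊎ p ∸ a ∈ ps
unrefinable⇒complement {ps} {p} {a} unrefinable p∈ps 1≤a a+a<p with a ∈? ps | p ∸ a ∈? ps
... | yes a∈ps | _        = inj₁ a∈ps
... | no  _    | yes b∈ps = inj₂ b∈ps
... | no  a∉ps | no  b∉ps = ⊥-elim (unrefinable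
      (p , a , p ∸ a , p∈ps , (1≤a , ≤-trans a≤p p≤L , a∉ps) ,
       (m<n⇒0<n∸m a<p , ≤-trans (m∸n≤m p a) p≤L , b∉ps) , a≢p∸a , m+[n∸m]≡n a≤p))
  where
    p≤L = ∈⇒≤largest ps p∈ps
    a<p = ≤-<-trans (m≤m+n a a) a+a<p
    a≤p = <⇒≤ a<p
    a≢p∸a : a ≢ p ∸ a
    a≢p∸a a≡p∸a = <⇒≢ a+a<p (trans (cong (a +_) a≡p∸a) (m+[n∸m]≡n a≤p))

initial-segment⇒unrefinable : ∀ {k qs} → (∀ {a} → 1 ≤ a → a < k → a ∈ qs) →
                              All (_≤ k + k) qs → Unrefinable qs
initial-segment⇒unrefinable {k} {qs} covers bounded
  (p , a , b , p∈qs , a-missing , b-missing , a≢b , a+b≡p) =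
  <⇒≱ k+k<a+b (subst (_≤ k + k) (sym a+b≡p) (All.lookup bounded p∈qs))
  where
    k≤missing : ∀ {x} → Missing qs x → k ≤ x
    k≤missing (1≤x , _ , x∉qs) = ≮⇒≥ (x∉qs ∘ covers 1≤x)
    k≤a = k≤missing a-missing
    k≤b = k≤missing b-missing
    k+k<a+b : k + k < a + b
    k+k<a+b = [ (λ a≤b → +-mono-≤-< k≤a (≤-<-trans k≤a (≤∧≢⇒< a≤b a≢b))) ,
                (λ b≤a → +-mono-<-≤ (≤-<-trans k≤b (≤∧≢⇒< b≤a (a≢b ∘ sym))) k≤b) ]′
              (≤-total a b)

-- The possible contributions of the pair {a, L ∸ a} when at least one of its members is a part.
data PairValue (L a : ℕ) : ℕ → Set where
  lower : PairValue L a a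
  upper : PairValue L a (L ∸ a)
  both  : PairValue L a L

Excess : (ℕ → Set) → ℕ → ℕ → ℕ → Set
Excess E g a v = ∃[ x ] v ≡ a + x × (E x ⊎ g ≤ x)

Excess⇒≤ : ∀ {E g a v} → Excess E g a v → a ≤ v
Excess⇒≤ {a = a} (x , refl , _) = m≤m+n a x

Excess-+ : ∀ {E : ℕ → Set} {g a b v w} → (∀ {x y} → E x → E y → E (x + y)) →
           Excess E g a v → Excess E g b w → Excess E g (a + b) (v + w)
Excess-+ {E} {g} {a} {b} E-+ (x , refl , x-small) (y , refl , y-small) =
  x + y , interchange a x b y , combine x-small y-small
  where
    combine : E x ⊎ g ≤ x → E y ⊎ g ≤ y → E (x + y) ⊎ g ≤ x + y
    combine (inj₁ Ex)  (inj₁ Ey)  = inj₁ (E-+ Ex Ey)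
    combine (inj₁ _)   (inj₂ g≤y) = inj₂ (≤-trans g≤y (m≤n+m y x))
    combine (inj₂ g≤x) _          = inj₂ (≤-trans g≤x (m≤m+n x y))

sumFrom-Excess : ∀ {E : ℕ → Set} {g} c j → E 0 → (∀ {x y} → E x → E y → E (x + y)) →
                 (∀ {a} → 1 ≤ a → a ≤ j → Excess E g a (c a)) →
                 Excess E g (T j) (sumFrom c 1 j)
sumFrom-Excess         c zero    E0 E-+ _      = 0 , refl , inj₁ E0
sumFrom-Excess {E} {g} c (suc j) E0 E-+ excess =
  subst (Excess E g (T (suc j))) (sym (sumFrom-snoc c 1 j))
    (Excess-+ E-+ (sumFrom-Excess c j E0 E-+ (λ 1≤a a≤j → excess 1≤a (m≤n⇒m≤1+n a≤j)))
                  (excess (s≤s z≤n) ≤-refl))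

PairValue⇒gap : ∀ {L a g v} → a + a + g ≤ L → PairValue L a v → Excess (_≡ 0) g a v
PairValue⇒gap {a = a} _ lower = 0 , sym (+-identityʳ a) , inj₁ refl
PairValue⇒gap {L} {a} {g} a+a+g≤L upper =
  L ∸ a ∸ a , sym (m+[n∸m]≡n (m+n≤o⇒n≤o∸m a a+a≤L)) ,
  inj₂ (subst (g ≤_) (sym (∸-+-assoc L a a)) (m+n≤o⇒n≤o∸m (a + a) a+a+g≤L))
  where a+a≤L = m+n≤o⇒m≤o (a + a) a+a+g≤L
PairValue⇒gap {L} {a} {g} a+a+g≤L both =
  L ∸ a , sym (m+[n∸m]≡n (m+n≤o⇒m≤o a a+g≤L)) , inj₂ (m+n≤o⇒n≤o∸m a a+g≤L)
  where a+g≤L = ≤-trans (+-monoˡ-≤ g (m≤m+n a a)) a+a+g≤L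

PairValue⇒parity : ∀ {K a v} → a < K → PairValue (K + K) a v → Excess (2 ∣_) (suc K) a v
PairValue⇒parity {a = a} _ lower = 0 , sym (+-identityʳ a) , inj₁ (2 ∣0)
PairValue⇒parity {a = a} a<K upper with m≤n⇒∃[o]m+o≡n (<⇒≤ a<K)
... | r , refl = r + r , reflect , inj₁ (divides r (double r))
  where
    regroup : ∀ a r → a + r + (a + r) ≡ a + (r + r) + a
    regroup = solve-∀
    reflect : a + r + (a + r) ∸ a ≡ a + (r + r)
    reflect = trans (cong (_∸ a) (regroup a r)) (m+n∸n≡m (a + (r + r)) a)
    double : ∀ r → r + r ≡ r * 2
    double = solve-∀
PairValue⇒parity {K} {a} a<K both =
  K + K ∸ a , sym (m+[n∸m]≡n (m+n≤o⇒m≤o a a+1+K≤K+K)) , inj₂ (m+n≤o⇒n≤o∸m a a+1+K≤K+K)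
  where a+1+K≤K+K = subst (_≤ K + K) (sym (+-suc a K)) (+-monoˡ-< K a<K)

module PairStructure {N ps} (up : UnrefinablePartition N ps) where
  open DistinctPartition (proj₁ up)

  L : ℕ
  L = largest ps

  unique : Unique ps
  unique = AllPairs.map <⇒≢ (Linked⇒AllPairs <-trans increasing)

  L∈ps : L ∈ ps
  L∈ps = largest∈ ps (≤-trans (s≤s z≤n) atLeastTwo)

  pair : ℕ → ℕ
  pair a = weight ps a + weight ps (L ∸ a)

  sum-by-pairs : ∀ j len → suc (j + j + len) ≡ L →
                 N ≡ sumFrom pair 1 j + sumFrom (weight ps) (suc j) len + L
  sum-by-pairs j len eq = begin
    N
      ≡⟨ sums ⟨
    sum ps
      ≡⟨ sum≡sumFrom-weight ps (All.tabulate (∈⇒≤largest ps)) ⟩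
    sumFrom (weight ps) 0 (suc L)
      ≡⟨ cong (sumFrom (weight ps) 0 ∘ suc) eq ⟨
    weight ps 0 + sumFrom (weight ps) 1 (suc M)
      ≡⟨ cong₂ _+_ (weight-∉ ps 0∉ps) (sumFrom-snoc (weight ps) 1 M) ⟩
    sumFrom (weight ps) 1 M + weight ps (suc M)
      ≡⟨ cong₂ _+_ (sumFrom-pairs (weight ps) j len eq)
                   (trans (cong (weight ps) eq) (weight-∈ unique L∈ps)) ⟩
    sumFrom pair 1 j + sumFrom (weight ps) (suc j) len + L ∎
    where
      open ≡-Reasoning
      M = j + j + len
      0∉ps : 0 ∉ ps
      0∉ps 0∈ps = <-irrefl refl (All.lookup positive 0∈ps)

  pairValue : ∀ {a} → 1 ≤ a → a + a < L → PairValue L a (pair a)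
  pairValue {a} 1≤a a+a<L with a ∈? ps | L ∸ a ∈? ps
  ... | yes a∈ps | yes b∈ps = subst (PairValue L a)
        (sym (trans (cong₂ _+_ (weight-∈ unique a∈ps) (weight-∈ unique b∈ps)) (m+[n∸m]≡n a≤L)))
        both
    where a≤L = ≤-trans (m≤m+n a a) (<⇒≤ a+a<L)
  ... | yes a∈ps | no  b∉ps = subst (PairValue L a)
        (sym (trans (cong₂ _+_ (weight-∈ unique a∈ps) (weight-∉ ps b∉ps)) (+-identityʳ a)))
        lower
  ... | no  a∉ps | yes b∈ps = subst (PairValue L a)
        (sym (cong₂ _+_ (weight-∉ ps a∉ps) (weight-∈ unique b∈ps)))
        upper
  ... | no  a∉ps | no  b∉ps =
        ⊥-elim ([ a∉ps , b∉ps ]′ (unrefinable⇒complement (proj₂ up) L∈ps 1≤a a+a<L))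

  pair-of-part : ∀ {a} → a ∈ ps → pair a ≡ a ⊎ pair a ≡ L
  pair-of-part {a} a∈ps with weight-cases unique (L ∸ a)
  ... | inj₁ w≡0 = inj₁ (trans (cong₂ _+_ (weight-∈ unique a∈ps) w≡0) (+-identityʳ a))
  ... | inj₂ w≡  =
        inj₂ (trans (cong₂ _+_ (weight-∈ unique a∈ps) w≡) (m+[n∸m]≡n (∈⇒≤largest ps a∈ps)))

  pairs-gap : ∀ {j g} → 1 ≤ g → j + j + g ≤ L → Excess (_≡ 0) g (T j) (sumFrom pair 1 j)
  pairs-gap {j} {g} 1≤g j+j+g≤L =
    sumFrom-Excess pair j refl (λ { refl refl → refl }) λ {a} 1≤a a≤j →
      let a+a+g≤L = ≤-trans (+-monoˡ-≤ g (+-mono-≤ a≤j a≤j)) j+j+g≤L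
      in  PairValue⇒gap a+a+g≤L (pairValue 1≤a (<-≤-trans (m<m+n (a + a) 1≤g) a+a+g≤L))

  pairs-parity : ∀ {j K} → L ≡ K + K → j < K →
                 Excess (2 ∣_) (suc K) (T j) (sumFrom pair 1 j)
  pairs-parity {j} {K} L≡K+K j<K =
    sumFrom-Excess pair j (2 ∣0) ∣m∣n⇒∣m+n λ {a} 1≤a a≤j →
      let a<K = ≤-<-trans a≤j j<K
      in  PairValue⇒parity a<K (subst (λ M → PairValue M a (pair a)) L≡K+K
            (pairValue 1≤a (subst (a + a <_) (sym L≡K+K) (+-mono-< a<K a<K))))

largest≤k+k+2 : ∀ {k ps} → UnrefinablePartition (T (2 + k)) ps → largest ps ≤ k + k + 2
largest≤k+k+2 {k} {ps} up = ≮⇒≥ too-large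
  where
    open PairStructure up
    pairs-end : ∀ k → suc k + suc k + 1 ≡ suc (k + k + 2)
    pairs-end = solve-∀
    sum-end : ∀ k e → suc (suc k + suc k + e) ≡ suc (k + k + 2) + e
    sum-end = solve-∀
    2+k≤k+k+2 : 2 + k ≤ k + k + 2
    2+k≤k+k+2 = subst (_≤ k + k + 2) (+-comm k 2) (+-monoˡ-≤ 2 (m≤n+m k k))
    too-large : k + k + 2 < L → ⊥
    too-large k+k+3≤L = <-irrefl refl (begin-strict
      T (2 + k)            ≡⟨⟩
      T (1 + k) + (2 + k)  <⟨ +-monoʳ-< (T (1 + k)) (≤-<-trans 2+k≤k+k+2 k+k+3≤L) ⟩
      T (1 + k) + L        ≤⟨ +-monoˡ-≤ L (Excess⇒≤ (pairs-gap (s≤s z≤n) k+1+k+1+1≤L)) ⟩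
      P + L                ≤⟨ +-monoˡ-≤ L (m≤m+n P middle) ⟩
      P + middle + L       ≡⟨ sum-by-pairs (1 + k) e (trans (sum-end k e) k+k+3+e≡L) ⟨
      T (2 + k)            ∎)
      where
        open ≤-Reasoning
        e = proj₁ (m≤n⇒∃[o]m+o≡n k+k+3≤L)
        k+k+3+e≡L = proj₂ (m≤n⇒∃[o]m+o≡n k+k+3≤L)
        k+1+k+1+1≤L = subst (_≤ L) (sym (pairs-end k)) k+k+3≤L
        P = sumFrom pair 1 (1 + k)
        middle = sumFrom (weight ps) (2 + k) e

largest≢k+k+2 : ∀ {k ps} → 1 ≤ k → UnrefinablePartition (T (2 + k)) ps → k + k + 2 ≢ largest ps
largest≢k+k+2 {k} {ps} 1≤k up k+k+2≡L =
  impossible (pairs-gap {k} (s≤s z≤n) (≤-reflexive k+k+2≡L))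
  where
    open PairStructure up
    P = sumFrom pair 1 k
    m = weight ps (suc k)
    expand : ∀ t k → t + suc k + suc (suc k) ≡ t + 1 + (k + k + 2)
    expand = solve-∀
    impossible : Excess (_≡ 0) 2 (T k) P → ⊥
    impossible (x , P≡T+x , x≡0⊎2≤x) = [ no-excess , large-excess ]′ x≡0⊎2≤x
      where
        balance : T k + (x + m) + L ≡ T k + 1 + L
        balance = begin
          T k + (x + m) + L      ≡⟨ cong (_+ L) (trans (sym (+-assoc (T k) x m))
                                      (cong₂ _+_ (sym P≡T+x) (sym (+-identityʳ m)))) ⟩
          P + (m + 0) + L        ≡⟨ sum-by-pairs k 1 (trans (sym (+-suc (k + k) 1)) k+k+2≡L) ⟨
          T (2 + k)              ≡⟨ expand (T k) k ⟩
          T k + 1 + (k + k + 2)  ≡⟨ cong (T k + 1 +_) k+k+2≡L ⟩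
          T k + 1 + L            ∎
          where open ≡-Reasoning
        x+m≡1 : x + m ≡ 1
        x+m≡1 = +-cancelˡʳ-≡ (T k) L balance
        no-excess : x ≡ 0 → ⊥
        no-excess x≡0 =
          [ (λ m≡0   → 0≢1+n (trans (sym m≡0) m≡1)) ,
            (λ m≡1+k → <⇒≢ 1≤k (sym (suc-injective (trans (sym m≡1+k) m≡1)))) ]′
          (weight-cases unique (suc k))
          where m≡1 = trans (cong (_+ m) (sym x≡0)) x+m≡1
        large-excess : 2 ≤ x → ⊥
        large-excess 2≤x = <⇒≱ 2≤x (subst (x ≤_) x+m≡1 (m≤m+n x m))

largest≢k+k+1 : ∀ {k ps} → 2 ≤ k → UnrefinablePartition (T (2 + k)) ps → k ∈ ps →
                k + k + 1 ≢ largest ps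
largest≢k+k+1 {suc j} {ps} 2≤k up k∈ps k+k+1≡L =
  impossible (pairs-gap {j} (s≤s z≤n) (≤-reflexive (trans (gap-shape j) k+k+1≡L)))
  where
    open PairStructure up
    k = suc j
    P = sumFrom pair 1 j
    gap-shape : ∀ j → j + j + 3 ≡ suc j + suc j + 1
    gap-shape = solve-∀
    expand : ∀ t j → t + suc j + suc (suc j) + suc (suc (suc j)) ≡
                     t + (suc j + 2) + (suc j + suc j + 1)
    expand = solve-∀
    k≤pair-k : k ≤ pair k
    k≤pair-k = [ ≤-reflexive ∘ sym ,
                 (λ pair-k≡L → subst (k ≤_) (sym pair-k≡L) (∈⇒≤largest ps k∈ps)) ]′
               (pair-of-part k∈ps)
    k+2<L : k + 2 < L
    k+2<L = subst (k + 2 <_) (trans (sym (+-assoc k k 1)) k+k+1≡L)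
              (+-monoʳ-< k (subst (2 <_) (sym (+-comm k 1)) (s≤s 2≤k)))
    impossible : Excess (_≡ 0) 3 (T j) P → ⊥
    impossible (x , P≡T+x , x≡0⊎3≤x) = [ no-excess , large-excess ]′ x≡0⊎3≤x
      where
        balance : T j + (x + pair k) + L ≡ T j + (k + 2) + L
        balance = begin
          T j + (x + pair k) + L       ≡⟨ cong (_+ L) (trans (sym (+-assoc (T j) x (pair k)))
                                            (cong (_+ pair k) (sym P≡T+x))) ⟩
          P + pair k + L               ≡⟨ cong (_+ L) (trans (+-identityʳ (sumFrom pair 1 k))
                                                            (sumFrom-snoc pair 1 j)) ⟨
          sumFrom pair 1 k + 0 + L     ≡⟨ sum-by-pairs k 0 (trans (sym (+-suc (k + k) 0)) k+k+1≡L) ⟨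
          T (2 + k)                    ≡⟨ expand (T j) j ⟩
          T j + (k + 2) + (k + k + 1)  ≡⟨ cong (T j + (k + 2) +_) k+k+1≡L ⟩
          T j + (k + 2) + L            ∎
          where open ≡-Reasoning
        x+pair-k≡k+2 : x + pair k ≡ k + 2
        x+pair-k≡k+2 = +-cancelˡʳ-≡ (T j) L balance
        no-excess : x ≡ 0 → ⊥
        no-excess x≡0 =
          [ (λ pair-k≡k → <⇒≢ (m<m+n k (s≤s z≤n)) (trans (sym pair-k≡k) pair-k≡k+2)) ,
            (λ pair-k≡L → <⇒≢ k+2<L (trans (sym pair-k≡k+2) pair-k≡L)) ]′
          (pair-of-part k∈ps)
          where pair-k≡k+2 = trans (cong (_+ pair k) (sym x≡0)) x+pair-k≡k+2
        large-excess : 3 ≤ x → ⊥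
        large-excess 3≤x = <⇒≱ (s≤s (≤-reflexive (+-comm k 2)))
          (subst (3 + k ≤_) x+pair-k≡k+2 (+-mono-≤ 3≤x k≤pair-k))

2∤3 : ¬ 2 ∣ 3
2∤3 (divides (suc (suc _)) ())

largest≢k+k : ∀ {k ps} → 3 ≤ k → UnrefinablePartition (T (2 + k)) ps → k ∈ ps → k + k ≢ largest ps
largest≢k+k {suc j} {ps} 3≤k up k∈ps k+k≡L = impossible (pairs-parity (sym k+k≡L) ≤-refl)
  where
    open PairStructure up
    k = suc j
    P = sumFrom pair 1 j
    expand : ∀ t j → t + suc j + suc (suc j) + suc (suc (suc j)) ≡
                     t + 3 + (suc j + (suc j + suc j))
    expand = solve-∀
    middle-shape : ∀ j → suc (j + j + 1) ≡ suc j + suc j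
    middle-shape = solve-∀
    impossible : Excess (2 ∣_) (suc k) (T j) P → ⊥
    impossible (x , P≡T+x , even⊎large) =
      [ 2∤3 ∘ subst (2 ∣_) x≡3 , <⇒≱ 3≤k ∘ s≤s⁻¹ ∘ subst (suc k ≤_) x≡3 ]′ even⊎large
      where
        balance : T j + x + (k + L) ≡ T j + 3 + (k + L)
        balance = begin
          T j + x + (k + L)          ≡⟨ cong (_+ (k + L)) (sym P≡T+x) ⟩
          P + (k + L)                ≡⟨ +-assoc P k L ⟨
          P + k + L                  ≡⟨ cong (λ w → P + w + L)
                                          (trans (+-identityʳ _) (weight-∈ unique k∈ps)) ⟨
          P + (weight ps k + 0) + L  ≡⟨ sum-by-pairs j 1 (trans (middle-shape j) k+k≡L) ⟨
          T (2 + k)                  ≡⟨ expand (T j) j ⟩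
          T j + 3 + (k + (k + k))    ≡⟨ cong (λ y → T j + 3 + (k + y)) k+k≡L ⟩
          T j + 3 + (k + L)          ∎
          where open ≡-Reasoning
        x≡3 : x ≡ 3
        x≡3 = +-cancelˡʳ-≡ (T j) (k + L) balance

largest≥k+k⇒k∉ : ∀ {k ps} → 4 ≤ k → UnrefinablePartition (T (2 + k)) ps → k + k ≤ largest ps →
                 k ∉ ps
largest≥k+k⇒k∉ {k} 4≤k up k+k≤L k∈ps with m≤n⇒∃[o]m+o≡n k+k≤L
... | 0 , k+k+0≡L =
  largest≢k+k (≤-trans (n≤1+n 3) 4≤k) up k∈ps (trans (sym (+-identityʳ (k + k))) k+k+0≡L)
... | 1 , k+k+1≡L = largest≢k+k+1 (≤-trans (s≤s (s≤s z≤n)) 4≤k) up k∈ps k+k+1≡L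
... | 2 , k+k+2≡L = largest≢k+k+2 (≤-trans (s≤s z≤n) 4≤k) up k+k+2≡L
... | suc (suc (suc d)) , k+k+3+d≡L =
  <⇒≱ (subst (k + k + 2 <_) k+k+3+d≡L (+-monoʳ-< (k + k) (s≤s (s≤s (s≤s z≤n)))))
      (largest≤k+k+2 up)

sum-applyUpTo-suc : ∀ n → sum (applyUpTo suc n) ≡ T n
sum-applyUpTo-suc zero    = refl
sum-applyUpTo-suc (suc n) = begin
  sum (applyUpTo suc (suc n))          ≡⟨ cong sum (applyUpTo-∷ʳ suc n) ⟨
  sum (applyUpTo suc n ∷ʳ suc n)       ≡⟨ sum-++ (applyUpTo suc n) (suc n ∷ []) ⟩
  sum (applyUpTo suc n) + (suc n + 0)  ≡⟨ cong₂ _+_ (sum-applyUpTo-suc n) (+-identityʳ (suc n)) ⟩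
  T n + suc n                          ∎
  where open ≡-Reasoning

unrefinable-largest≥k+k : ∀ {k} → 4 ≤ k →
                          ∃[ qs ] UnrefinablePartition (T (2 + k)) qs × k + k ≤ largest qs
unrefinable-largest≥k+k {suc j} (s≤s 3≤j) =
  qs , (partition , initial-segment⇒unrefinable covers bounded) ,
  ∈⇒≤largest qs (∈-++⁺ʳ small (there (here refl)))
  where
    k = suc j
    small = applyUpTo suc j
    large = k + 3 ∷ k + k ∷ []
    qs = small ++ large
    small-range : ∀ {x} → x ∈ small → 1 ≤ x × x < k
    small-range x∈small with i , i<j , refl ← ∈-applyUpTo⁻ suc x∈small = s≤s z≤n , s≤s i<j
    k+3<k+k : k + 3 < k + k
    k+3<k+k = +-monoʳ-< k (s≤s 3≤j)
    covers : ∀ {a} → 1 ≤ a → a < k → a ∈ qs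
    covers {suc i} _ (s≤s i<j) = ∈-++⁺ˡ (∈-applyUpTo⁺ suc i<j)
    bounded : All (_≤ k + k) qs
    bounded = Allₚ.++⁺
      (All.tabulate (λ x∈small → <⇒≤ (<-≤-trans (proj₂ (small-range x∈small)) (m≤m+n k k))))
      (<⇒≤ k+3<k+k ∷ ≤-refl ∷ [])
    expand : ∀ t j → t + (suc j + 3 + (suc j + suc j + 0)) ≡
                     t + suc j + suc (suc j) + suc (suc (suc j))
    expand = solve-∀
    partition : DistinctPartition (T (2 + k)) qs
    partition = record
      { increasing = AllPairs⇒Linked (AllPairsₚ.++⁺
          (Linked⇒AllPairs <-trans (applyUpTo⁺₂ suc j (λ _ → ≤-refl)))
          ((k+3<k+k ∷ []) ∷ [] ∷ [])
          (All.tabulate (λ x∈small → let x<k = proj₂ (small-range x∈small) in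
             <-≤-trans x<k (m≤m+n k 3) ∷ <-≤-trans x<k (m≤m+n k k) ∷ [])))
      ; positive   = Allₚ.++⁺ (All.tabulate (proj₁ ∘ small-range)) (s≤s z≤n ∷ s≤s z≤n ∷ [])
      ; atLeastTwo = subst (2 ≤_) (sym (length-++ small)) (m≤n+m 2 (length small))
      ; sums       = trans (sum-++ small large)
                           (trans (cong (_+ sum large) (sum-applyUpTo-suc j)) (expand (T j) j))
      }

corollary5p1 : (n : ℕ) → 6 ≤ n → (ps : List ℕ) → MaximalUnrefinable (T n) ps → (n ∸ 2) ∉ ps
corollary5p1 (suc (suc k)) (s≤s (s≤s 4≤k)) ps (up , maximal) =
  let qs , qs-up , k+k≤largest-qs = unrefinable-largest≥k+k 4≤k
  in  largest≥k+k⇒k∉ 4≤k up (≤-trans k+k≤largest-qs (maximal qs qs-up))
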